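{- For all formulas $A_1,\ldots,A_m,B$ of 3-valued Łukasiewicz logic: if there is an $\mathcal{H}\text{Łuk}$ derivation of $B$ from $A_1,\ldots,A_m$ in $n$ steps, then there are $\mathcal{H}\text{Łuk}$ proofs in $O(m+n)$ steps of $A_1\supset(A_1\supset(\ldots\supset(A_m\supset(A_m\supset B))))$ and of $(\neg(A_1\supset\neg A_1)\wedge\ldots\wedge\neg(A_m\supset\neg A_m))\supset B$, where the conjunction is associated arbitrarily.
   Context: Formulas are built from propositional variables with $\wedge,\vee,\supset,\neg$. $\mathcal{H}\text{Łuk}$ (Avron's Frege system for 3-valued Łukasiewicz logic) has the axiom schemas: (1) $A\supset(B\supset A)$; (2) $(A\supset B)\supset((B\supset C)\supset(A\supset C))$; (3) $((A\supset B)\supset B)\supset((B\supset A)\supset A)$; (4) $((((A\supset B)\supset A)\supset A)\supset(B\supset C))\supset(B\supset C)$; (5) $(A\wedge B)\supset A$; (6) $(A\wedge B)\supset B$; (7) $(A\supset B)\supset((A\supset C)\supset(A\supset(B\wedge C)))$; (8) $A\supset(A\vee B)$; (9) $B\supset(A\vee B)$; (10) $(A\supset C)\supset((B\supset C)\supset((A\vee B)\supset C))$; (11) $(\neg B\supset\neg A)\supset(A\supset B)$; its only rule is modus ponens. A derivation of $B$ from a set $\Gamma$ is a finite sequence of formulas ending in $B$, each an axiom instance, a member of $\Gamma$, or obtained from two earlier ones by modus ponens; a proof is a derivation from $\emptyset$; steps = length of the sequence. -}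

module Defs where

open import Data.Nat using (ℕ; suc; _+_; _*_; _≤_)
open import Data.List using (List; []; _∷_; length; map; foldr)
open import Data.List.Membership.Propositional using (_∈_)
open import Data.Product using (Σ; _×_)
open import Relation.Binary.PropositionalEquality using (_≡_)

infixr 5 _⊃_
infixr 6 _∨_
infixr 7 _∧_
data Formula : Set where
  var : ℕ → Formula
  _∧_ : Formula → Formula → Formula
  _∨_ : Formula → Formula → Formula
  _⊃_ : Formula → Formula → Formula
  ¬_  : Formula → Formula

data Axiom : Formula → Set where
  ax1  : ∀ A B → Axiom (A ⊃ (B ⊃ A))
  ax2  : ∀ A B C → Axiom ((A ⊃ B) ⊃ ((B ⊃ C) ⊃ (A ⊃ C)))
  ax3  : ∀ A B → Axiom (((A ⊃ B) ⊃ B) ⊃ ((B ⊃ A) ⊃ A))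
  ax4  : ∀ A B C → Axiom (((((A ⊃ B) ⊃ A) ⊃ A) ⊃ (B ⊃ C)) ⊃ (B ⊃ C))
  ax5  : ∀ A B → Axiom ((A ∧ B) ⊃ A)
  ax6  : ∀ A B → Axiom ((A ∧ B) ⊃ B)
  ax7  : ∀ A B C → Axiom ((A ⊃ B) ⊃ ((A ⊃ C) ⊃ (A ⊃ (B ∧ C))))
  ax8  : ∀ A B → Axiom (A ⊃ (A ∨ B))
  ax9  : ∀ A B → Axiom (B ⊃ (A ∨ B))
  ax10 : ∀ A B C → Axiom ((A ⊃ C) ⊃ ((B ⊃ C) ⊃ ((A ∨ B) ⊃ C)))
  ax11 : ∀ A B → Axiom ((¬ B ⊃ ¬ A) ⊃ (A ⊃ B))

-- ValidSeq Γ s : the list s, read in REVERSE (head = last formula written),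
-- is a correct derivation sequence from hypotheses Γ.
data ValidSeq (Γ : List Formula) : List Formula → Set where
  done : ValidSeq Γ []
  axm  : ∀ {s A} → ValidSeq Γ s → Axiom A → ValidSeq Γ (A ∷ s)
  hyp  : ∀ {s A} → ValidSeq Γ s → A ∈ Γ → ValidSeq Γ (A ∷ s)
  mp   : ∀ {s A B} → ValidSeq Γ s → (A ⊃ B) ∈ s → A ∈ s → ValidSeq Γ (B ∷ s)

DerivesIn : List Formula → Formula → ℕ → Set
DerivesIn Γ B n = Σ (List Formula) λ s → ValidSeq Γ (B ∷ s) × length (B ∷ s) ≡ n

ProvableIn≤ : Formula → ℕ → Set
ProvableIn≤ B k = Σ ℕ λ n → DerivesIn [] B n × n ≤ k

doubleImp : List Formula → Formula → Formula
doubleImp [] B = B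
doubleImp (A ∷ As) B = A ⊃ (A ⊃ doubleImp As B)

sq : Formula → Formula
sq A = ¬ (A ⊃ ¬ A)

-- Arbitrarily associated nonempty conjunctions: binary trees with formula leaves
data ConjTree : Set where
  leaf : Formula → ConjTree
  node : ConjTree → ConjTree → ConjTree

toFormula : ConjTree → Formula
toFormula (leaf A) = A
toFormula (node l r) = toFormula l ∧ toFormula r

leaves : ConjTree → List Formula
leaves (leaf A) = A ∷ []
leaves (node l r) = leaves l Data.List.++ leaves r

-- In Ł3, sq A = ¬(A ⊃ ¬A) is the strong square A ⊙ A, so sq A ⊃ X and
-- A ⊃ A ⊃ X are interderivable.  This gives a deduction theorem: if every hypothesis A
-- satisfies Φ ⊃ sq A, then each line C of the derivation can be replaced by Φ ⊃ Φ ⊃ C using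
-- a constant number of new lines (for modus ponens, axiom 4 contracts Φ ⊃ Φ ⊃ Φ ⊃ Φ ⊃ D back
-- to Φ ⊃ Φ ⊃ D), citing the lines produced for earlier steps instead of re-proving them.
-- For Φ the conjunction of the sq Aᵢ, the projections Φ ⊃ sq Aᵢ cost a constant per
-- ∧-node, and Φ is classical (Φ ∨ ¬Φ holds, because every sq A is classical and classical
-- formulas are closed under ∧), which lets Φ ⊃ Φ ⊃ B contract to Φ ⊃ B.  Taking Φ
-- left-nested and exporting its conjuncts one at a time then yields A₁ ⊃ A₁ ⊃ … ⊃ B.
module Submission where

open import Defs
open import Data.Nat using (ℕ; _+_; _*_)
open import Data.List using (List; length; map)
open import Data.Product using (Σ; _×_)
open import Relation.Binary.PropositionalEquality using (_≡_)

open import Data.Bool using (T)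
open import Data.List using ([]; _∷_; _++_)
open import Data.List.Properties using (length-++; length-map; ++-identityʳ; ++-assoc)
open import Data.List.Membership.Propositional using (_∈_)
open import Data.List.Relation.Binary.Subset.Propositional using (_⊆_)
open import Data.List.Relation.Binary.Subset.Propositional.Properties using (⊆-refl; ⊆-trans)
open import Data.List.Relation.Unary.All as All using (All; []; _∷_)
open import Data.List.Relation.Unary.All.Properties using (++⁺; ++⁻; map⁺; map⁻)
open import Data.List.Relation.Unary.Any using (here; there)
open import Data.Nat using (suc; _≤_; z≤n; _≤ᵇ_)
open import Data.Nat.Properties
open import Data.Nat.Tactic.RingSolver using (solve-∀)
open import Data.Product using (_,_; ∃)
open import Relation.Binary.PropositionalEquality using (refl; sym; trans; cong; cong₂; subst; module ≡-Reasoning)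

variable
  Γ : List Formula
  A B C D E F X : Formula
  Γ₀ Δ Λ As : List Formula
  m n : ℕ
  P Q : List Formula → Set

infix  2 _⊢_
infixl 9 _·_
infixr 7 _⨾_ _⨾²_
infixr 5 _⊃²_
infixr 6 _⊔_

_⊃²_ : Formula → Formula → Formula
A ⊃² B = A ⊃ A ⊃ B

-- Łukasiewicz disjunction: (A ⊃ B) ⊃ B takes the value max(A, B).
_⊔_ : Formula → Formula → Formula
A ⊔ B = (A ⊃ B) ⊃ B

Classical : Formula → Formula
Classical A = A ⊔ ¬ A

-- Proof trees whose leaves may cite lines already present in Γ.  Citing is free, so
-- `size` counts exactly the lines that writing the tree out after Γ appends.
data _⊢_ (Γ : List Formula) : Formula → Set where
  ax   : Axiom A → Γ ⊢ A
  line : A ∈ Γ → Γ ⊢ A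
  _·_  : Γ ⊢ A ⊃ B → Γ ⊢ A → Γ ⊢ B

size : Γ ⊢ A → ℕ
size (ax _)   = 1
size (line _) = 0
size (p · q)  = suc (size p + size q)

_⨾_ : Γ ⊢ A ⊃ B → Γ ⊢ B ⊃ C → Γ ⊢ A ⊃ C
p ⨾ q = ax (ax2 _ _ _) · p · q

assert : Γ ⊢ A ⊃ (A ⊃ B) ⊃ B
assert = ax (ax1 _ _) ⨾ ax (ax3 _ _)

swap : Γ ⊢ (A ⊃ B ⊃ C) ⊃ B ⊃ A ⊃ C
swap = ax (ax2 _ _ _) ⨾ ax (ax2 _ _ _) · assert

flip : Γ ⊢ A ⊃ B ⊃ C → Γ ⊢ B ⊃ A ⊃ C
flip p = swap · p

prefix : Γ ⊢ (B ⊃ C) ⊃ (A ⊃ B) ⊃ A ⊃ C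
prefix = flip (ax (ax2 _ _ _))

under : Γ ⊢ B ⊃ C → Γ ⊢ (A ⊃ B) ⊃ A ⊃ C
under p = prefix · p

prefix₂ : Γ ⊢ (B ⊃ C) ⊃ (E ⊃ F ⊃ B) ⊃ E ⊃ F ⊃ C
prefix₂ = prefix ⨾ prefix

id : Γ ⊢ A ⊃ A
id {A = A} = flip (ax (ax1 A (A ⊃² A))) · ax (ax1 A A)

const² : Γ ⊢ A ⊃ X ⊃² A
const² = ax (ax1 _ _) ⨾ ax (ax1 _ _)

exfalso : Γ ⊢ ¬ A ⊃ A ⊃ B
exfalso = ax (ax1 _ _) ⨾ ax (ax11 _ _)

¬¬-elim : Γ ⊢ ¬ ¬ A ⊃ A
¬¬-elim {A = A} = exfalso ⨾ ax (ax11 _ _) ⨾ assert · ax (ax1 A A)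

¬¬-intro : Γ ⊢ A ⊃ ¬ ¬ A
¬¬-intro = ax (ax11 _ _) · ¬¬-elim

contraposition-¬ : Γ ⊢ (A ⊃ ¬ B) ⊃ B ⊃ ¬ A
contraposition-¬ = ax (ax2 _ _ _) · ¬¬-elim ⨾ ax (ax11 _ _)

contraposition : Γ ⊢ (A ⊃ B) ⊃ ¬ B ⊃ ¬ A
contraposition = under ¬¬-intro ⨾ contraposition-¬

pair : Γ ⊢ A ⊃ B ⊃ A ∧ B
pair = flip (ax (ax1 _ _) ⨾ ax (ax7 _ _ _)) · id

curry : Γ ⊢ (E ∧ F ⊃ X) ⊃ E ⊃ F ⊃ X
curry = flip prefix₂ · pair

⊔-elim : Γ ⊢ (A ⊃ C) ⊃ (B ⊃ C) ⊃ A ⊔ B ⊃ C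
⊔-elim {A = A} {C = C} {B = B} =
  ax (ax2 A C B) ⨾ ax (ax2 (C ⊃ B) (A ⊃ B) B) ⨾ under (ax (ax3 C B)) ⨾ swap

-- Axiom 4 gives ((X ⊃² D) ⊔ X) ⊔ (X ⊔ D), and each of X ⊃² D, X, D yields the conclusion.
contract : Γ ⊢ (X ⊃ X ⊃² D) ⊃ X ⊃² D
contract =
  ⊔-elim · (⊔-elim · ax (ax1 _ _) · assert) · (⊔-elim · assert · (const² ⨾ ax (ax1 _ _)))
    · ax (ax4 _ _ _)

contract² : Γ ⊢ (X ⊃² X ⊃² D) ⊃ X ⊃² D
contract² = contract ⨾ contract

⊃-mp : Γ ⊢ (X ⊃ C ⊃ D) ⊃ (X ⊃ C) ⊃ X ⊃² D
⊃-mp = under prefix ⨾ swap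

⊃²-mp : Γ ⊢ (X ⊃² (C ⊃ D)) ⊃ (X ⊃² C) ⊃ X ⊃² D
⊃²-mp = under ⊃-mp ⨾ ⊃-mp ⨾ under contract²

_⨾²_ : Γ ⊢ A ⊃² B → Γ ⊢ B ⊃² C → Γ ⊢ A ⊃² C
p ⨾² q = contract² · (p ⨾ under q ⨾ under (flip prefix₂ · p))

sq-elim : Γ ⊢ sq A ⊃ A
sq-elim = ax (ax11 _ _) · (ax (ax1 _ _) ⨾ ¬¬-intro)

sq-intro : Γ ⊢ A ⊃² sq A
sq-intro = assert ⨾ contraposition-¬

residuate : Γ ⊢ (sq A ⊃ X) ⊃ A ⊃² X
residuate = flip prefix₂ · sq-intro

unresiduate : Γ ⊢ (A ⊃² X) ⊃ sq A ⊃ X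
unresiduate = under contraposition ⨾ swap ⨾ under ¬¬-intro ⨾ ax (ax11 _ _)

-- Classicality of sq A is sq A ⊃ sq (sq A) in disguise; residuation turns that into
-- A ⊃² sq (sq A), which is sq-intro chained with itself.
sq-classical : Γ ⊢ Classical (sq A)
sq-classical = contraposition-¬ · (unresiduate · (sq-intro ⨾² sq-intro))

∧-classical : Γ ⊢ Classical A ⊃ Classical B ⊃ Classical (A ∧ B)
∧-classical = ⊔-elim · (pair ⨾ under assert ⨾ flip ⊔-elim · ¬right) · (¬left ⨾ ax (ax1 _ _))
  where
    ¬left : Γ ⊢ ¬ A ⊃ Classical (A ∧ B)
    ¬left = contraposition · ax (ax5 _ _) ⨾ ax (ax1 _ _)
    ¬right : Γ ⊢ ¬ B ⊃ Classical (A ∧ B)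
    ¬right = contraposition · ax (ax6 _ _) ⨾ ax (ax1 _ _)

classical-contract : Γ ⊢ Classical A ⊃ (A ⊃² B) ⊃ A ⊃ B
classical-contract = ⊔-elim · assert · (exfalso ⨾ ax (ax1 _ _))

sq-hypothesis : Γ ⊢ (X ⊃ sq A) ⊃ X ⊃² A
sq-hypothesis = under sq-elim ⨾ ax (ax1 _ _)

export-sq : Γ ⊢ (E ∧ sq A ⊃ X) ⊃ E ⊃ A ⊃² X
export-sq = curry ⨾ under residuate

record Extension (Γ : List Formula) (n : ℕ) (P : List Formula → Set) : Set where
  constructor extension
  field
    {lines}  : List Formula
    valid    : ValidSeq [] lines
    extends  : Γ ⊆ lines
    bounded  : length lines ≤ length Γ + n
    property : P lines

data EndsWith (A : Formula) : List Formula → Set where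
  endsWith : EndsWith A (A ∷ Δ)

return : ValidSeq [] Γ → P Γ → Extension Γ 0 P
return v p = extension v ⊆-refl (m≤m+n _ 0) p

infixl 1 _>>=_ _<&>_

_>>=_ : Extension Γ m P → (∀ {Δ} → ValidSeq [] Δ → Γ ⊆ Δ → P Δ → Extension Δ n Q) →
        Extension Γ (m + n) Q
_>>=_ {Γ = Γ} {m = m} {n = n} (extension v e b p) k with k v e p
... | extension v′ e′ b′ q =
  extension v′ (⊆-trans e e′) (≤-trans b′ (≤-trans (+-monoˡ-≤ n b) (≤-reflexive (+-assoc (length Γ) m n))))
            q

_<&>_ : Extension Γ n P → (∀ {Δ} → Γ ⊆ Δ → P Δ → Q Δ) → Extension Γ n Q
extension v e b p <&> f = extension v e b (f e p)

weaken : m ≤ n → Extension Γ m P → Extension Γ n P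
weaken {Γ = Γ} m≤n (extension v e b p) = extension v e (≤-trans b (+-monoʳ-≤ (length Γ) m≤n)) p

recost : m ≡ n → Extension Γ m P → Extension Γ n P
recost m≡n = weaken (≤-reflexive m≡n)

append : ValidSeq [] (A ∷ Γ) → Extension Γ 1 (EndsWith A)
append {Γ = Γ} v = extension v there (≤-reflexive (+-comm 1 (length Γ))) endsWith

mutual
  flatten : Γ₀ ⊆ Γ → ValidSeq [] Γ → (p : Γ₀ ⊢ A) → Extension Γ (size p) (A ∈_)
  flatten _ v (ax a)   = append (axm v a) <&> λ { _ endsWith → here refl }
  flatten e v (line i) = return v (e i)
  flatten e v (p · q)  = flatten-· e v p q <&> λ { _ endsWith → here refl }

  flatten-· : Γ₀ ⊆ Γ → ValidSeq [] Γ → (p : Γ₀ ⊢ A ⊃ B) (q : Γ₀ ⊢ A) →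
              Extension Γ (size (p · q)) (EndsWith B)
  flatten-· e v p q = recost (trans (cong (size p +_) (+-comm (size q) 1)) (+-suc (size p) (size q))) (
    flatten e v p >>= λ v₁ e₁ i →
    flatten (⊆-trans e e₁) v₁ q >>= λ v₂ e₂ j →
    append (mp v₂ (e₂ i) j))

-- Every tree written out by `step` has at most K nodes.  K is opaque so that the
-- typechecker never unfolds the costs n * K.
maxStep : ℕ
maxStep = 1000

opaque
  K : ℕ
  K = maxStep

  fits : (n : ℕ) → {T (n ≤ᵇ maxStep)} → n ≤ K
  fits n {n≤K} = ≤ᵇ⇒≤ n maxStep n≤K

step : ValidSeq [] Γ → (p : Γ ⊢ A) → {T (size p ≤ᵇ maxStep)} → Extension Γ K (A ∈_)
step v p {p≤K} = weaken (fits (size p) {p≤K}) (flatten ⊆-refl v p)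

conclude : Extension [] n (A ∈_) → ProvableIn≤ A (n + K)
conclude E = proof (E >>= λ v _ i → weaken (fits _) (flatten-· ⊆-refl v id (line i)))
  where
    proof : Extension [] m (EndsWith A) → ProvableIn≤ A m
    proof (extension {_ ∷ Δ} v _ b endsWith) = suc (length Δ) , (Δ , v , refl) , b

extend-all : {f : Formula → Formula} →
  Extension Γ (length Λ * K) (λ Δ → All (λ C → f C ∈ Δ) Λ) →
  (∀ {Δ} → ValidSeq [] Δ → Γ ⊆ Δ → All (λ C → f C ∈ Δ) Λ → Extension Δ K (f A ∈_)) →
  Extension Γ (length (A ∷ Λ) * K) (λ Δ → All (λ C → f C ∈ Δ) (A ∷ Λ))
extend-all {Λ = Λ} E next = recost (+-comm (length Λ * K) K) (
  E >>= λ v e fs → next v e fs <&> λ e′ fA → fA ∷ All.map e′ fs)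

nodes : ConjTree → ℕ
nodes (leaf _)   = 1
nodes (node l r) = suc (nodes l + nodes r)

nodes-leaves : ∀ U → suc (nodes U) ≡ 2 * length (leaves U)
nodes-leaves (leaf _)   = refl
nodes-leaves (node l r) = begin
  suc (suc (nodes l + nodes r))                 ≡⟨ cong suc (sym (+-suc (nodes l) (nodes r))) ⟩
  suc (nodes l) + suc (nodes r)                 ≡⟨ cong₂ _+_ (nodes-leaves l) (nodes-leaves r) ⟩
  2 * length (leaves l) + 2 * length (leaves r) ≡⟨ sym (*-distribˡ-+ 2 (length (leaves l)) _) ⟩
  2 * (length (leaves l) + length (leaves r))   ≡⟨ cong (2 *_) (sym (length-++ (leaves l))) ⟩
  2 * length (leaves l ++ leaves r)             ∎
  where open ≡-Reasoning

nodes-squares : ∀ U → leaves U ≡ map sq As → suc (nodes U) ≡ 2 * length As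
nodes-squares {As = As} U eq = trans (nodes-leaves U) (cong (2 *_) (trans (cong length eq) (length-map sq As)))

leftConj : ConjTree → List Formula → ConjTree
leftConj E []      = E
leftConj E (A ∷ Λ) = leftConj (node E (leaf (sq A))) Λ

leaves-leftConj : ∀ E Λ → leaves (leftConj E Λ) ≡ leaves E ++ map sq Λ
leaves-leftConj E []      = sym (++-identityʳ (leaves E))
leaves-leftConj E (A ∷ Λ) = trans (leaves-leftConj (node E (leaf (sq A))) Λ) (++-assoc (leaves E) _ _)

Square : Formula → Set
Square x = ∃ λ A → x ≡ sq A

classical-tree : ∀ U → All Square (leaves U) → ValidSeq [] Γ →
                 Extension Γ (nodes U * K) (Classical (toFormula U) ∈_)
classical-tree (leaf _) ((_ , refl) ∷ []) v = weaken (m≤m+n K 0) (step v sq-classical)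
classical-tree (node l r) squares v with ++⁻ (leaves l) squares
... | squaresˡ , squaresʳ = recost (cost (nodes l) (nodes r) K) (
  classical-tree l squaresˡ v >>= λ v₁ _ cˡ →
  classical-tree r squaresʳ v₁ >>= λ v₂ e₂ cʳ →
  step v₂ (∧-classical · line (e₂ cˡ) · line cʳ))
  where
    cost : ∀ a b k → a * k + (b * k + k) ≡ suc (a + b) * k
    cost = solve-∀

module _ (Φ : Formula) where

  leaf-implications : ∀ U → (Φ ⊃ toFormula U) ∈ Γ → ValidSeq [] Γ →
                      Extension Γ (nodes U * (2 * K)) (λ Δ → All (λ x → (Φ ⊃ x) ∈ Δ) (leaves U))
  leaf-implications (leaf _) h v = weaken z≤n (return v (h ∷ []))
  leaf-implications (node l r) h v = recost (cost (nodes l) (nodes r) K) (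
    step v (under (ax (ax5 _ _)) · line h) >>= λ v₁ e₁ hˡ →
    step v₁ (under (ax (ax6 _ _)) · line (e₁ h)) >>= λ v₂ e₂ hʳ →
    leaf-implications l (e₂ hˡ) v₂ >>= λ v₃ e₃ leavesˡ →
    leaf-implications r (e₃ hʳ) v₃ <&> λ e₄ leavesʳ → ++⁺ (All.map e₄ leavesˡ) leavesʳ)
    where
      cost : ∀ a b k → k + (k + (a * (2 * k) + b * (2 * k))) ≡ suc (a + b) * (2 * k)
      cost = solve-∀

  deduce : ValidSeq As Λ → ValidSeq [] Γ → All (λ A → (Φ ⊃ sq A) ∈ Γ) As →
           Extension Γ (length Λ * K) (λ Δ → All (λ C → (Φ ⊃² C) ∈ Δ) Λ)
  deduce done v hyps = return v []
  deduce (axm w a) v hyps = extend-all (deduce w v hyps) λ v′ _ _ →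
    step v′ (const² · ax a)
  deduce (hyp w i) v hyps = extend-all (deduce w v hyps) λ v′ e _ →
    step v′ (sq-hypothesis · line (e (All.lookup hyps i)))
  deduce (mp w i j) v hyps = extend-all (deduce w v hyps) λ v′ _ earlier →
    step v′ (⊃²-mp · line (All.lookup earlier i) · line (All.lookup earlier j))

export-leaves : ∀ E Λ → (toFormula (leftConj E Λ) ⊃ B) ∈ Γ → ValidSeq [] Γ →
                Extension Γ (length Λ * K) ((toFormula E ⊃ doubleImp Λ B) ∈_)
export-leaves E [] h v = return v h
export-leaves E (A ∷ Λ) h v = recost (+-comm (length Λ * K) K) (
  export-leaves (node E (leaf (sq A))) Λ h v >>= λ v′ _ h′ →
  step v′ (export-sq · line h′))

implication-from-conjunction : ∀ U → leaves U ≡ map sq As → ValidSeq As (B ∷ Λ) →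
  Extension [] ((3 * nodes U + length (B ∷ Λ) + 2) * K) ((toFormula U ⊃ B) ∈_)
implication-from-conjunction {As = As} {B = B} {Λ = Λ} U eq w =
  recost (cost (nodes U) (length (B ∷ Λ)) K) (
    step done id >>= λ v₁ _ h →
    leaf-implications Φ U h v₁ >>= λ v₂ _ conjuncts →
    classical-tree U squares v₂ >>= λ v₃ e₃ classicalΦ →
    deduce Φ w v₃ (hypotheses e₃ conjuncts) >>= λ v₄ e₄ deduced →
    step v₄ (classical-contract · line (e₄ classicalΦ) · line (All.head deduced)))
  where
    Φ : Formula
    Φ = toFormula U
    squares : All Square (leaves U)
    squares = subst (All Square) (sym eq) (map⁺ (All.universal (λ A → A , refl) As))
    hypotheses : Γ ⊆ Δ → All (λ x → (Φ ⊃ x) ∈ Γ) (leaves U) → All (λ A → (Φ ⊃ sq A) ∈ Δ) As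
    hypotheses e conjuncts = map⁻ (All.map e (subst (All _) eq conjuncts))
    cost : ∀ a n k → k + (a * (2 * k) + (a * k + (n * k + k))) ≡ (3 * a + n + 2) * k
    cost = solve-∀

c : ℕ
c = 7 * K

steps-bound : ∀ m n → 3 * (2 * m) + n + m ≤ 7 * (m + n)
steps-bound m n = subst (3 * (2 * m) + n + m ≤_) (slack m n) (m≤m+n _ (6 * n))
  where
    slack : ∀ m n → 3 * (2 * m) + n + m + 6 * n ≡ 7 * (m + n)
    slack = solve-∀

within-c : ∀ {x y} → x ≤ 7 * y → x * K ≤ c * y
within-c {x} {y} x≤7y = ≤-trans (*-monoˡ-≤ K x≤7y) (≤-reflexive (reorder y K))
  where
    reorder : ∀ y k → 7 * y * k ≡ 7 * k * y
    reorder = solve-∀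

n≤c*n : ∀ n → n ≤ c * n
n≤c*n n = begin
  n       ≡⟨ *-identityʳ n ⟨
  n * 1   ≤⟨ *-monoʳ-≤ n (fits 1) ⟩
  n * K   ≤⟨ within-c (m≤n*m n 7) ⟩
  c * n   ∎
  where open ≤-Reasoning

provable-mono : m ≤ n → ProvableIn≤ A m → ProvableIn≤ A n
provable-mono m≤n (l , d , l≤m) = l , d , ≤-trans l≤m m≤n

conjunction-bound : ∀ N m n → suc N ≡ 2 * m → (3 * N + n + 2) * K + K ≤ c * (m + n)
conjunction-bound N m n nodes≡ = begin
  (3 * N + n + 2) * K + K   ≡⟨ regroup N n K ⟩
  (3 * suc N + n) * K       ≡⟨ cong (λ x → (3 * x + n) * K) nodes≡ ⟩
  (3 * (2 * m) + n) * K     ≤⟨ within-c (≤-trans (m≤m+n _ m) (steps-bound m n)) ⟩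
  c * (m + n)               ∎
  where
    open ≤-Reasoning
    regroup : ∀ a n k → (3 * a + n + 2) * k + k ≡ (3 * suc a + n) * k
    regroup = solve-∀

double-implication-bound : ∀ N r n → suc N ≡ 2 * suc r →
  (3 * N + n + 2) * K + (r * K + K) + K ≤ c * (suc r + n)
double-implication-bound N r n nodes≡ = begin
  (3 * N + n + 2) * K + (r * K + K) + K   ≡⟨ regroup N r n K ⟩
  (3 * suc N + n + suc r) * K             ≡⟨ cong (λ x → (3 * x + n + suc r) * K) nodes≡ ⟩
  (3 * (2 * suc r) + n + suc r) * K       ≤⟨ within-c (steps-bound (suc r) n) ⟩
  c * (suc r + n)                         ∎
  where
    open ≤-Reasoning
    regroup : ∀ a r n k → (3 * a + n + 2) * k + (r * k + k) + k ≡ (3 * suc a + n + suc r) * k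
    regroup = solve-∀

conjunction-implication : ValidSeq As (B ∷ Λ) → (U : ConjTree) → leaves U ≡ map sq As →
  ProvableIn≤ (toFormula U ⊃ B) (c * (length As + length (B ∷ Λ)))
conjunction-implication {As = As} {B = B} {Λ = Λ} w U eq =
  provable-mono (conjunction-bound (nodes U) (length As) (length (B ∷ Λ)) (nodes-squares U eq))
    (conclude (implication-from-conjunction U eq w))

double-implication : ∀ As → ValidSeq As (B ∷ Λ) →
  ProvableIn≤ (doubleImp As B) (c * (length As + length (B ∷ Λ)))
double-implication {B = B} {Λ = Λ} [] w = _ , (Λ , w , refl) , n≤c*n (length (B ∷ Λ))
double-implication {B = B} {Λ = Λ} (A ∷ As) w =
  provable-mono
    (double-implication-bound (nodes U) (length As) (length (B ∷ Λ)) (nodes-squares U eq))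
    (conclude (
      implication-from-conjunction U eq w >>= λ v _ h →
      export-leaves (leaf (sq A)) As h v >>= λ v′ _ h′ →
      step v′ (residuate · line h′)))
  where
    U : ConjTree
    U = leftConj (leaf (sq A)) As
    eq : leaves U ≡ map sq (A ∷ As)
    eq = leaves-leftConj (leaf (sq A)) As

theorem8 : Σ ℕ λ c → (As : List Formula) → (B : Formula) → (n : ℕ) → DerivesIn As B n →
    ProvableIn≤ (doubleImp As B) (c * (length As + n))
    × ((T : ConjTree) → leaves T ≡ map sq As → ProvableIn≤ (toFormula T ⊃ B) (c * (length As + n)))
theorem8 = c , λ { As B _ (Λ , w , refl) → double-implication As w , conjunction-implication w }
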